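{- Let $G$ be a matching covered graph and let $C:=\partial(X)$ be a 2-separation cut of $G$ associated with a 2-separation $\{u_1,u_2\}$, where $u_1\in X$ and $u_2\in\overline{X}$. Let $H$ be the graph obtained from $G$ by contracting $\overline{X}$ to a single vertex $\overline{x}$ (removing loops). Let $S_H$ be either a 2-separation or a barrier of $H$, and let $S:=S_H$ if $\overline{x}\notin S_H$, and $S:=(S_H-\overline{x})\cup\{u_2\}$ if $\overline{x}\in S_H$. Then: (i) every component of $H-S_H$ that contains no vertex of $\{u_1,\overline{x}\}$ is a component of $G-S$; (ii) at most one component of $H-S_H$ contains vertices of $\{u_1,\overline{x}\}$; (iii) if $S_H$ is a barrier of $H$ then $S$ is a barrier of $G$, and if $S_H$ is a 2-separation of $H$ then $S$ is a 2-separation of $G$.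
   Context: Graphs are finite, may have multiple edges, no loops. For $X\subseteq V(G)$, $\overline{X}=V(G)-X$ and $\partial(X)$ is the set of edges with exactly one end in $X$. A graph is matching covered if it is connected, has at least one edge, and every edge lies in some perfect matching. A barrier is a nonempty vertex set $B$ with $o(G-B)=|B|$, where $o$ counts components with an odd number of vertices. A 2-separation is a pair $\{u,v\}$ of vertices such that $G-\{u,v\}$ is disconnected and every component of $G-\{u,v\}$ has an even number of vertices. If $\{u,v\}$ is a 2-separation and $\{G_1,G_2\}$ is a partition of $G-\{u,v\}$ into two nonempty unions of components, then $\partial(V(G_1)\cup\{u\})$ and $\partial(V(G_1)\cup\{v\})$ are the 2-separation cuts associated with $\{u,v\}$. -}

module Defs where

open import Data.Nat using (ℕ; zero; suc; _%_)
open import Data.Fin using (Fin; _≟_)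
open import Data.Fin.Subset using (Subset; _∈_; _∉_; ∣_∣; ⁅_⁆; _∪_)
open import Data.Vec using (lookup; tabulate)
open import Data.Bool using (Bool; true; false; if_then_else_; _∧_)
open import Data.Product using (Σ; ∃; _×_; _,_; proj₁; proj₂)
open import Data.Sum using (_⊎_)
open import Relation.Nullary using (¬_)
open import Relation.Nullary.Decidable using (⌊_⌋)
open import Relation.Binary.PropositionalEquality using (_≡_; _≢_)
open import Relation.Binary.Construct.Closure.ReflexiveTransitive using (Star)
open import Function.Definitions using (Injective)

-- Finite loopless multigraph: vertices Fin nV, edges Fin nE,
-- each edge has an (arbitrarily oriented) pair of distinct ends.
record Graph : Set where
  field
    nV : ℕ
    nE : ℕ
    ends : Fin nE → Fin nV × Fin nV
    loopless : ∀ e → proj₁ (ends e) ≢ proj₂ (ends e)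
open Graph public

Vtx : Graph → Set
Vtx G = Fin (nV G)

VSet : Graph → Set
VSet G = Subset (nV G)

Odd : ℕ → Set
Odd k = k % 2 ≡ 1

Even : ℕ → Set
Even k = k % 2 ≡ 0

Joins : (G : Graph) → Fin (nE G) → Vtx G → Vtx G → Set
Joins G e a b = (ends G e ≡ (a , b)) ⊎ (ends G e ≡ (b , a))

Step : (G : Graph) → VSet G → Vtx G → Vtx G → Set
Step G S a b = a ∉ S × b ∉ S × ∃ λ e → Joins G e a b

Conn : (G : Graph) → VSet G → Vtx G → Vtx G → Set
Conn G S a b = a ∉ S × Star (Step G S) a b

IsComponent : (G : Graph) → VSet G → VSet G → Set
IsComponent G S K =
  (∃ λ v → v ∈ K) ×
  (∀ v → v ∈ K → v ∉ S) ×
  (∀ u v → u ∈ K → ((v ∈ K → Conn G S u v) × (Conn G S u v → v ∈ K)))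

OddComponentCount : (G : Graph) → VSet G → ℕ → Set
OddComponentCount G S k =
  Σ (Fin k → VSet G) λ f →
    Injective _≡_ _≡_ f ×
    (∀ i → IsComponent G S (f i) × Odd ∣ f i ∣) ×
    (∀ K → IsComponent G S K → Odd ∣ K ∣ → ∃ λ i → f i ≡ K)

IsBarrier : (G : Graph) → VSet G → Set
IsBarrier G B = (∃ λ v → v ∈ B) × OddComponentCount G B ∣ B ∣

IsTwoSepPair : (G : Graph) → Vtx G → Vtx G → Set
IsTwoSepPair G u v =
  u ≢ v ×
  (∃ λ a → ∃ λ b → a ∉ S × b ∉ S × ¬ Conn G S a b) ×
  (∀ K → IsComponent G S K → Even ∣ K ∣)
  where S = ⁅ u ⁆ ∪ ⁅ v ⁆

IsTwoSep : (G : Graph) → VSet G → Set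
IsTwoSep G S = ∃ λ u → ∃ λ v → S ≡ ⁅ u ⁆ ∪ ⁅ v ⁆ × IsTwoSepPair G u v

Incident : (G : Graph) → Vtx G → Fin (nE G) → Set
Incident G v e = (proj₁ (ends G e) ≡ v) ⊎ (proj₂ (ends G e) ≡ v)

IsPerfectMatching : (G : Graph) → Subset (nE G) → Set
IsPerfectMatching G M =
  ∀ v → ∃ λ e → e ∈ M × Incident G v e ×
        (∀ e' → e' ∈ M → Incident G v e' → e' ≡ e)

Connected : Graph → Set
Connected G = ∀ u v → Conn G (tabulate λ _ → false) u v

IsMatchingCovered : Graph → Set
IsMatchingCovered G =
  Connected G × Fin (nE G) ×
  (∀ e → ∃ λ M → IsPerfectMatching G M × e ∈ M)

-- ∂(X) is a 2-separation cut associated with the 2-separation {u1 , u2},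
-- u1 ∈ X, u2 ∉ X: X = V(G1) ∪ {u1} where V(G1) and its complement in
-- G - {u1,u2} are nonempty unions of components of G - {u1,u2}.
IsTwoSepCut : (G : Graph) → VSet G → Vtx G → Vtx G → Set
IsTwoSepCut G X u1 u2 =
  IsTwoSepPair G u1 u2 × u1 ∈ X × u2 ∉ X ×
  (∀ a b → Conn G S a b → a ∈ X → b ∈ X) ×
  (∃ λ a → a ∉ S × a ∈ X) ×
  (∃ λ b → b ∉ S × b ∉ X)
  where S = ⁅ u1 ⁆ ∪ ⁅ u2 ⁆

-- H is obtained from G by contracting the complement of X to the single
-- vertex xbar (and removing loops), witnessed by the vertex map ι
-- and the edge map ψ (edges of H ↦ edges of G).
record IsContraction (G : Graph) (X : VSet G) (H : Graph)
       (xbar : Vtx H) (ι : Vtx G → Vtx H) : Set where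
  field
    outside : ∀ v → v ∉ X → ι v ≡ xbar
    inside  : ∀ v → v ∈ X → ι v ≢ xbar
    injX    : ∀ v w → v ∈ X → w ∈ X → ι v ≡ ι w → v ≡ w
    surj    : ∀ y → ∃ λ v → ι v ≡ y
    ψ       : Fin (nE H) → Fin (nE G)
    ψ-inj   : Injective _≡_ _≡_ ψ
    ψ-ends  : ∀ h → ends H h ≡ (ι (proj₁ (ends G (ψ h))) , ι (proj₂ (ends G (ψ h))))
    ψ-image : ∀ e → (proj₁ (ends G e) ∈ X ⊎ proj₂ (ends G e) ∈ X) → ∃ λ h → ψ h ≡ e

-- S := S_H if xbar ∉ S_H, and (S_H - xbar) ∪ {u2} if xbar ∈ S_H
liftSet : (G H : Graph) → VSet G → Vtx H → (Vtx G → Vtx H) → Vtx G → VSet H → VSet G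
liftSet G H X xbar ι u2 SH = tabulate λ v →
  if lookup X v then lookup SH (ι v) else (⌊ v ≟ u2 ⌋ ∧ lookup SH xbar)

-- a vertex set of H avoiding xbar, viewed as a vertex set of G
pullback : (G H : Graph) → (Vtx G → Vtx H) → VSet H → VSet G
pullback G H ι K = tabulate λ v → lookup K (ι v)

-- Contracting the complement of X identifies the vertices of H with X ∪ {u2}, u2 standing for
-- xbar, and under this identification SH becomes S. A path of H − SH lifts to G − S: an edge of
-- H at xbar comes from an edge a b with b ∉ X, and either b = u2 or b lies in a component of
-- G − {u1, u2} outside X, which (G being matching covered) has a neighbour of u2. Conversely a
-- path of G − S projects to H − SH, its excursions outside X collapsing onto xbar, or onto ι u1
-- when xbar ∈ SH (then u2 ∈ S and such excursions start and end at u1). Hence the components of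
-- H − SH correspond to the components of G − S that meet X ∪ {u2}, each of which gains only a
-- union of even components of G − {u1, u2}, while every other component of G − S is such a
-- union. So parities of components and |S| = |SH| are preserved, which yields (i) and (iii);
-- (ii) holds because u1 has a neighbour outside X, so ι u1 and xbar are adjacent in H.

module Submission where

open import Data.Nat using (ℕ; zero; suc; _+_; _≤_; _<_; _%_; s≤s)
open import Data.Nat.Properties using (+-suc; ≤-reflexive; ≤-trans; ≤-pred; n≤1+n; n≮0; m<n+m; 0<1+n)
open import Data.Nat.DivMod using (%-distribˡ-+; m%n<n)
open import Data.Nat.Induction using (<-rec)
open import Data.Fin using (Fin; _≟_)
import Data.Fin as F
open import Data.Fin.Properties using (any?)
open import Data.Fin.Subset using (Subset; _∈_; _∉_; ∣_∣; ⁅_⁆; _∪_; ∁)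
open import Data.Fin.Subset.Properties
  using (_∈?_; ⊆-antisym; ∪-comm; x∈⁅x⁆; x∈⁅y⁆⇒x≡y; x∈⁅y⁆⇔x≡y; ∣⁅x⁆∣≡1; ∣p∣≤n; p⊂q⇒∣p∣<∣q∣; x∈p∪q⁻; x∈p∪q⁺; p⊆p∪q;
         x∉p⇒x∈∁p; x∈∁p⇒x∉p)
open import Data.Vec using (tabulate; lookup)
open import Data.Vec.Properties using (lookup∘tabulate; []=⇒lookup; lookup⇒[]=)
open import Data.Bool using (true; false; if_then_else_; _∧_)
import Data.Product
open import Data.Product using (∃; _×_; _,_; proj₁; proj₂)
open import Data.Product.Properties using (≡-dec; ,-injective; ,-injectiveʳ; ×-≡,≡→≡)
open import Data.Empty using (⊥-elim)
import Data.Sum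
open import Data.Sum using (_⊎_; inj₁; inj₂; [_,_]′)
open import Relation.Nullary using (¬_; Dec; yes; no; does)
open import Relation.Nullary.Decidable using (⌊_⌋; dec-true; _⊎-dec_; _×-dec_)
open import Relation.Unary using (Decidable)
open import Relation.Unary.Properties using (_∩?_; ∁?)
open import Relation.Binary.PropositionalEquality
  using (_≡_; _≢_; refl; sym; trans; cong; subst; subst₂; module ≡-Reasoning)
open import Function using (_∘_)
open import Relation.Binary.Construct.Closure.ReflexiveTransitive using (Star; ε; _◅_; _◅◅_; reverse)
open import Level using (0ℓ; _⊔_) renaming (suc to lsuc)
open import Function.Bundles using (Equivalence)
open import Defs

+-%2 : ∀ m n → (m + n) % 2 ≡ (m % 2 + n % 2) % 2
+-%2 m n = %-distribˡ-+ m n 2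

even+even⇒even : ∀ {m n} → Even m → Even n → Even (m + n)
even+even⇒even {m} {n} em en rewrite +-%2 m n | em | en = refl

odd+even⇒odd : ∀ {m n} → Odd m → Even n → Odd (m + n)
odd+even⇒odd {m} {n} om en rewrite +-%2 m n | om | en = refl

even⇒odd-suc : ∀ {n} → Even n → Odd (suc n)
even⇒odd-suc {n} = odd+even⇒odd {1} {n} refl

even⇒¬odd : ∀ {n} → Even n → ¬ Odd n
even⇒¬odd {n} en on with () ← trans (sym en) on

even⊎odd : ∀ n → Even n ⊎ Odd n
even⊎odd n with n % 2 | m%n<n n 2
... | 0 | _ = inj₁ refl
... | 1 | _ = inj₂ refl
... | suc (suc _) | s≤s (s≤s ())

-- Counting the elements of decidable subsets

module _ {n : ℕ} where

  ⟦_⟧ : {P : Fin n → Set} → Decidable P → Subset n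
  ⟦ P? ⟧ = tabulate λ x → does (P? x)

  module _ {P : Fin n → Set} (P? : Decidable P) where

    ∈⟦⟧⁺ : ∀ {x} → P x → x ∈ ⟦ P? ⟧
    ∈⟦⟧⁺ {x} px = lookup⇒[]= x ⟦ P? ⟧ (trans (lookup∘tabulate _ x) (dec-true (P? x) px))

    ∈⟦⟧⁻ : ∀ {x} → x ∈ ⟦ P? ⟧ → P x
    ∈⟦⟧⁻ {x} x∈ = toWitness′ (P? x) (trans (sym (lookup∘tabulate _ x)) ([]=⇒lookup x∈))
      where
      toWitness′ : (d : Dec (P x)) → does d ≡ true → P x
      toWitness′ (yes px) _ = px
      toWitness′ (no _) ()

module _ {n : ℕ} {P Q : Fin n → Set} (P? : Decidable P) (Q? : Decidable Q) where

  ⟦⟧-cong : (∀ {x} → P x → Q x) → (∀ {x} → Q x → P x) → ⟦ P? ⟧ ≡ ⟦ Q? ⟧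
  ⟦⟧-cong P⇒Q Q⇒P = ⊆-antisym (λ x∈ → ∈⟦⟧⁺ Q? (P⇒Q (∈⟦⟧⁻ P? x∈))) (λ x∈ → ∈⟦⟧⁺ P? (Q⇒P (∈⟦⟧⁻ Q? x∈)))

⟦∈?⟧ : ∀ {n} (A : Subset n) → ⟦ _∈? A ⟧ ≡ A
⟦∈?⟧ A = ⊆-antisym (∈⟦⟧⁻ (_∈? A)) (∈⟦⟧⁺ (_∈? A))

∣⟦⟧∣≡0 : ∀ {n} {P : Fin n → Set} (P? : Decidable P) → (∀ x → ¬ P x) → ∣ ⟦ P? ⟧ ∣ ≡ 0
∣⟦⟧∣≡0 {zero} P? ¬P = refl
∣⟦⟧∣≡0 {suc n} P? ¬P with P? F.zero
... | yes p = ⊥-elim (¬P F.zero p)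
... | no _ = ∣⟦⟧∣≡0 (P? ∘ F.suc) (¬P ∘ F.suc)

∣⟦⟧∣-split : ∀ {n} {P Q : Fin n → Set} (P? : Decidable P) (Q? : Decidable Q) →
  ∣ ⟦ P? ⟧ ∣ ≡ ∣ ⟦ P? ∩? Q? ⟧ ∣ + ∣ ⟦ P? ∩? ∁? Q? ⟧ ∣
∣⟦⟧∣-split {zero} P? Q? = refl
∣⟦⟧∣-split {suc n} P? Q? with P? F.zero | Q? F.zero
... | yes _ | yes _ = cong suc (∣⟦⟧∣-split (P? ∘ F.suc) (Q? ∘ F.suc))
... | yes _ | no _ = trans (cong suc (∣⟦⟧∣-split (P? ∘ F.suc) (Q? ∘ F.suc))) (sym (+-suc _ _))
... | no _ | _ = ∣⟦⟧∣-split (P? ∘ F.suc) (Q? ∘ F.suc)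

∣⟦⟧∣-remove : ∀ {n} {P : Fin n → Set} (P? : Decidable P) {x} → P x →
  ∣ ⟦ P? ⟧ ∣ ≡ suc ∣ ⟦ P? ∩? ∁? (_≟ x) ⟧ ∣
∣⟦⟧∣-remove {P = P} P? {x} px = begin
  ∣ ⟦ P? ⟧ ∣                         ≡⟨ ∣⟦⟧∣-split P? (_≟ x) ⟩
  ∣ ⟦ P? ∩? (_≟ x) ⟧ ∣ + rest        ≡⟨ cong (λ A → ∣ A ∣ + rest) ⟦P∩≡x⟧≡⁅x⁆ ⟩
  ∣ ⁅ x ⁆ ∣ + rest                   ≡⟨ cong (_+ rest) (∣⁅x⁆∣≡1 x) ⟩
  suc rest                           ∎
  where
  open ≡-Reasoning
  rest = ∣ ⟦ P? ∩? ∁? (_≟ x) ⟧ ∣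
  P-at-x : ∀ {y} → y ≡ x → P y × y ≡ x
  P-at-x refl = px , refl
  ⟦P∩≡x⟧≡⁅x⁆ : ⟦ P? ∩? (_≟ x) ⟧ ≡ ⁅ x ⁆
  ⟦P∩≡x⟧≡⁅x⁆ = ⊆-antisym
    (λ y∈ → Equivalence.from x∈⁅y⁆⇔x≡y (proj₂ (∈⟦⟧⁻ (P? ∩? (_≟ x)) y∈)))
    (λ y∈ → ∈⟦⟧⁺ (P? ∩? (_≟ x)) (P-at-x (Equivalence.to x∈⁅y⁆⇔x≡y y∈)))

∣⟦⟧∣>0 : ∀ {n} {P : Fin n → Set} (P? : Decidable P) {x} → P x → 0 < ∣ ⟦ P? ⟧ ∣
∣⟦⟧∣>0 P? px = subst (0 <_) (sym (∣⟦⟧∣-remove P? px)) 0<1+n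

∣⟦⟧∣-induction : ∀ {n ℓ} (Goal : ∀ {P : Fin n → Set} → Decidable P → Set ℓ) →
  (∀ {P} (P? : Decidable P) → (∀ {Q} (Q? : Decidable Q) → ∣ ⟦ Q? ⟧ ∣ < ∣ ⟦ P? ⟧ ∣ → Goal Q?) → Goal P?) →
  ∀ {P} (P? : Decidable P) → Goal P?
∣⟦⟧∣-induction {n} {ℓ} Goal step P? = <-rec OfSize induct ∣ ⟦ P? ⟧ ∣ P? refl
  where
  OfSize : ℕ → Set (lsuc 0ℓ ⊔ ℓ)
  OfSize k = ∀ {P : Fin n → Set} (P? : Decidable P) → ∣ ⟦ P? ⟧ ∣ ≡ k → Goal P?
  induct : ∀ k → (∀ {j} → j < k → OfSize j) → OfSize k
  induct _ ih P? refl = step P? λ Q? lt → ih lt Q? refl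

∣⟦⟧∣-bijection : ∀ {m n} {P : Fin m → Set} {Q : Fin n → Set} (P? : Decidable P) (Q? : Decidable Q)
  (f : Fin m → Fin n) (g : Fin n → Fin m) →
  (∀ {x} → P x → Q (f x)) → (∀ {y} → Q y → P (g y)) →
  (∀ {x} → P x → g (f x) ≡ x) → (∀ {y} → Q y → f (g y) ≡ y) → ∣ ⟦ P? ⟧ ∣ ≡ ∣ ⟦ Q? ⟧ ∣
∣⟦⟧∣-bijection {m} {n} P? Q? f g = ∣⟦⟧∣-induction Bijective step P? Q?
  where
  Bijective : ∀ {P : Fin m → Set} → Decidable P → Set₁
  Bijective {P} P? = ∀ {Q : Fin n → Set} (Q? : Decidable Q) →
    (∀ {x} → P x → Q (f x)) → (∀ {y} → Q y → P (g y)) →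
    (∀ {x} → P x → g (f x) ≡ x) → (∀ {y} → Q y → f (g y) ≡ y) → ∣ ⟦ P? ⟧ ∣ ≡ ∣ ⟦ Q? ⟧ ∣
  step : ∀ {P} (P? : Decidable P) → (∀ {P′} (P′? : Decidable P′) → ∣ ⟦ P′? ⟧ ∣ < ∣ ⟦ P? ⟧ ∣ → Bijective P′?) →
    Bijective P?
  step {P} P? ih {Q} Q? fP gQ gf fg with any? P?
  ... | no ∄P = trans (∣⟦⟧∣≡0 P? λ x px → ∄P (x , px)) (sym (∣⟦⟧∣≡0 Q? λ y qy → ∄P (g y , gQ qy)))
  ... | yes (x , px) = begin
    ∣ ⟦ P? ⟧ ∣                              ≡⟨ ∣⟦⟧∣-remove P? px ⟩
    suc ∣ ⟦ P? ∩? ∁? (_≟ x) ⟧ ∣              ≡⟨ cong suc (ih (P? ∩? ∁? (_≟ x)) (≤-reflexive (sym (∣⟦⟧∣-remove P? px)))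
                                                  (Q? ∩? ∁? (_≟ f x)) fP′ gQ′ (gf ∘ proj₁) (fg ∘ proj₁)) ⟩
    suc ∣ ⟦ Q? ∩? ∁? (_≟ f x) ⟧ ∣            ≡⟨ sym (∣⟦⟧∣-remove Q? (fP px)) ⟩
    ∣ ⟦ Q? ⟧ ∣                              ∎
    where
    open ≡-Reasoning
    fP′ : ∀ {x′} → P x′ × x′ ≢ x → Q (f x′) × f x′ ≢ f x
    fP′ (px′ , x′≢x) = fP px′ , λ eq → x′≢x (trans (sym (gf px′)) (trans (cong g eq) (gf px)))
    gQ′ : ∀ {y} → Q y × y ≢ f x → P (g y) × g y ≢ x
    gQ′ (qy , y≢fx) = gQ qy , λ eq → y≢fx (trans (sym (fg qy)) (cong f eq))

involution⇒∣⟦⟧∣-even : ∀ {n} {P : Fin n → Set} (P? : Decidable P) (σ : Fin n → Fin n) →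
  (∀ {x} → P x → P (σ x)) → (∀ {x} → P x → σ x ≢ x) → (∀ {x} → P x → σ (σ x) ≡ x) →
  Even ∣ ⟦ P? ⟧ ∣
involution⇒∣⟦⟧∣-even {n} P? σ = ∣⟦⟧∣-induction Paired step P?
  where
  Paired : ∀ {P : Fin n → Set} → Decidable P → Set
  Paired {P} P? = (∀ {x} → P x → P (σ x)) → (∀ {x} → P x → σ x ≢ x) → (∀ {x} → P x → σ (σ x) ≡ x) →
    Even ∣ ⟦ P? ⟧ ∣
  step : ∀ {P} (P? : Decidable P) → (∀ {P′} (P′? : Decidable P′) → ∣ ⟦ P′? ⟧ ∣ < ∣ ⟦ P? ⟧ ∣ → Paired P′?) →
    Paired P?
  step {P} P? ih closed moves invol with any? P?
  ... | no ∄P = subst Even (sym (∣⟦⟧∣≡0 P? λ x px → ∄P (x , px))) refl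
  ... | yes (x , px) = subst Even (sym size) (even+even⇒even {2} {∣ ⟦ P″? ⟧ ∣} refl
        (ih P″? (≤-trans (n≤1+n _) (≤-reflexive (sym size))) closed″ (moves ∘ proj₁ ∘ proj₁) (invol ∘ proj₁ ∘ proj₁)))
    where
    P′? = P? ∩? ∁? (_≟ x)
    P″? = P′? ∩? ∁? (_≟ σ x)
    size : ∣ ⟦ P? ⟧ ∣ ≡ suc (suc ∣ ⟦ P″? ⟧ ∣)
    size = trans (∣⟦⟧∣-remove P? px) (cong suc (∣⟦⟧∣-remove P′? (closed px , moves px)))
    closed″ : ∀ {y} → (P y × y ≢ x) × y ≢ σ x → (P (σ y) × σ y ≢ x) × σ y ≢ σ x
    closed″ ((py , y≢x) , y≢σx) =
      (closed py , λ σy≡x → y≢σx (trans (sym (invol py)) (cong σ σy≡x))) ,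
      λ σy≡σx → y≢x (trans (sym (invol py)) (trans (cong σ σy≡σx) (invol px)))

-- Paths, connectivity and components

Star-preserves : ∀ {A : Set} {R : A → A → Set} (Q : A → Set) → (∀ {x y} → R x y → Q x → Q y) →
  ∀ {a b} → Star R a b → Q a → Q b
Star-preserves Q step ε qa = qa
Star-preserves Q step (r ◅ rs) qa = Star-preserves Q step rs (step r qa)

Star-exit : ∀ {A : Set} {R : A → A → Set} {Q : A → Set} → Decidable Q →
  ∀ {a b} → Star R a b → Q a → ¬ Q b → ∃ λ x → ∃ λ y → Q x × R x y × ¬ Q y
Star-exit Q? ε qa ¬qb = ⊥-elim (¬qb qa)
Star-exit Q? {a} (_◅_ {j = y} r rs) qa ¬qb with Q? y
... | yes qy = Star-exit Q? rs qy ¬qb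
... | no ¬qy = a , y , qa , r , ¬qy

module _ {n : ℕ} {a b : Fin n} where

  ∈⁅⁆∪⁅⁆⁻ : ∀ {x} → x ∈ ⁅ a ⁆ ∪ ⁅ b ⁆ → x ≡ a ⊎ x ≡ b
  ∈⁅⁆∪⁅⁆⁻ x∈ with x∈p∪q⁻ ⁅ a ⁆ ⁅ b ⁆ x∈
  ... | inj₁ x∈a = inj₁ (x∈⁅y⁆⇒x≡y a x∈a)
  ... | inj₂ x∈b = inj₂ (x∈⁅y⁆⇒x≡y b x∈b)

  ∉⁅⁆∪⁅⁆ : ∀ {x} → x ≢ a → x ≢ b → x ∉ ⁅ a ⁆ ∪ ⁅ b ⁆
  ∉⁅⁆∪⁅⁆ x≢a x≢b x∈ = [ x≢a , x≢b ]′ (∈⁅⁆∪⁅⁆⁻ x∈)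

  a∈⁅a⁆∪⁅b⁆ : a ∈ ⁅ a ⁆ ∪ ⁅ b ⁆
  a∈⁅a⁆∪⁅b⁆ = x∈p∪q⁺ (inj₁ (x∈⁅x⁆ a))

  b∈⁅a⁆∪⁅b⁆ : b ∈ ⁅ a ⁆ ∪ ⁅ b ⁆
  b∈⁅a⁆∪⁅b⁆ = x∈p∪q⁺ (inj₂ (x∈⁅x⁆ b))

Disconnects : (G : Graph) → VSet G → Set
Disconnects G S = ∃ λ a → ∃ λ b → a ∉ S × b ∉ S × ¬ Conn G S a b

HasEvenComponents : (G : Graph) → VSet G → Set
HasEvenComponents G S = ∀ K → IsComponent G S K → Even ∣ K ∣

module _ (G : Graph) where

  Adjacent : Vtx G → Vtx G → Set
  Adjacent a b = ∃ λ e → Joins G e a b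

  Joins-sym : ∀ {e a b} → Joins G e a b → Joins G e b a
  Joins-sym (inj₁ eq) = inj₂ eq
  Joins-sym (inj₂ eq) = inj₁ eq

  Joins⇒≢ : ∀ {e a b} → Joins G e a b → a ≢ b
  Joins⇒≢ {e} (inj₁ eq) refl = loopless G e (trans (cong proj₁ eq) (sym (cong proj₂ eq)))
  Joins⇒≢ {e} (inj₂ eq) refl = loopless G e (trans (cong proj₁ eq) (sym (cong proj₂ eq)))

  Adjacent-sym : ∀ {a b} → Adjacent a b → Adjacent b a
  Adjacent-sym (e , j) = e , Joins-sym j

  adjacent? : ∀ a b → Dec (Adjacent a b)
  adjacent? a b = any? λ e → ≡-dec _≟_ _≟_ (ends G e) (a , b) ⊎-dec ≡-dec _≟_ _≟_ (ends G e) (b , a)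

  Step-sym : ∀ {S a b} → Step G S a b → Step G S b a
  Step-sym (a∉S , b∉S , ab) = b∉S , a∉S , Adjacent-sym ab

  Star-∉ : ∀ {S a b} → Star (Step G S) a b → a ∉ S → b ∉ S
  Star-∉ = Star-preserves (_∉ _) λ (_ , b∉S , _) _ → b∉S

  Conn-refl : ∀ {S a} → a ∉ S → Conn G S a a
  Conn-refl a∉S = a∉S , ε

  Conn-∉ʳ : ∀ {S a b} → Conn G S a b → b ∉ S
  Conn-∉ʳ (a∉S , path) = Star-∉ path a∉S

  Conn-sym : ∀ {S a b} → Conn G S a b → Conn G S b a
  Conn-sym c@(_ , path) = Conn-∉ʳ c , reverse Step-sym path

  Conn-trans : ∀ {S a b c} → Conn G S a b → Conn G S b c → Conn G S a c
  Conn-trans (a∉S , p) (_ , q) = a∉S , p ◅◅ q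

  Step⇒Conn : ∀ {S a b} → Step G S a b → Conn G S a b
  Step⇒Conn st = proj₁ st , st ◅ ε

  Star-restrict : ∀ {S S′} (Q : Vtx G → Set) → (∀ {x} → Q x → x ∉ S′) → (∀ {x y} → Step G S x y → Q x → Q y) →
    ∀ {a b} → Star (Step G S) a b → Q a → Star (Step G S′) a b
  Star-restrict Q Q⇒∉S′ closed ε qa = ε
  Star-restrict Q Q⇒∉S′ closed (st@(_ , _ , ab) ◅ path) qa =
    (Q⇒∉S′ qa , Q⇒∉S′ (closed st qa) , ab) ◅ Star-restrict Q Q⇒∉S′ closed path (closed st qa)

  private
    ∉∪⁅⁆ : ∀ {S : VSet G} {a x} → x ∉ S → x ≢ a → x ∉ S ∪ ⁅ a ⁆
    ∉∪⁅⁆ {S} {a} x∉S x≢a x∈ with x∈p∪q⁻ S ⁅ a ⁆ x∈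
    ... | inj₁ x∈S = x∉S x∈S
    ... | inj₂ x∈a = x≢a (x∈⁅y⁆⇒x≡y a x∈a)

    ∉∪⁅⁆⇒∉ : ∀ {S : VSet G} {a x} → x ∉ S ∪ ⁅ a ⁆ → x ∉ S
    ∉∪⁅⁆⇒∉ {S} {a} x∉ x∈S = x∉ (p⊆p∪q ⁅ a ⁆ x∈S)

    avoiding⇒Star : ∀ {S : VSet G} {a x b} → Star (Step G (S ∪ ⁅ a ⁆)) x b → x ∉ S ∪ ⁅ a ⁆ → Star (Step G S) x b
    avoiding⇒Star {S} {a} = Star-restrict (_∉ S ∪ ⁅ a ⁆) ∉∪⁅⁆⇒∉ λ (_ , y∉ , _) _ → y∉

    last-visit : ∀ {S : VSet G} {a x b} → b ≢ a → Star (Step G S) x b →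
      (x ≢ a × Star (Step G (S ∪ ⁅ a ⁆)) x b) ⊎ (∃ λ c → Adjacent a c × Conn G (S ∪ ⁅ a ⁆) c b)
    last-visit b≢a ε = inj₁ (b≢a , ε)
    last-visit {S} {a} {x} b≢a (st@(x∉S , y∉S , xy) ◅ path) with last-visit b≢a path
    ... | inj₂ found = inj₂ found
    ... | inj₁ (y≢a , path′) with x ≟ a
    ...   | yes refl = inj₂ (_ , xy , ∉∪⁅⁆ y∉S y≢a , path′)
    ...   | no x≢a = inj₁ (x≢a , (∉∪⁅⁆ x∉S x≢a , ∉∪⁅⁆ y∉S y≢a , xy) ◅ path′)

    ∣∁S∪⁅a⁆∣<∣∁S∣ : ∀ {S : VSet G} {a} → a ∉ S → ∣ ∁ (S ∪ ⁅ a ⁆) ∣ < ∣ ∁ S ∣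
    ∣∁S∪⁅a⁆∣<∣∁S∣ {S} {a} a∉S = p⊂q⇒∣p∣<∣q∣ {p = ∁ (S ∪ ⁅ a ⁆)} {q = ∁ S}
      ( (λ x∈ → x∉p⇒x∈∁p (∉∪⁅⁆⇒∉ {S} {a} (x∈∁p⇒x∉p x∈)))
      , a , x∉p⇒x∈∁p a∉S , λ a∈ → x∈∁p⇒x∉p a∈ (x∈p∪q⁺ (inj₂ (x∈⁅x⁆ a))))

    shrink : ∀ {S : VSet G} {a k} → a ∉ S → ∣ ∁ S ∣ ≤ suc k → ∣ ∁ (S ∪ ⁅ a ⁆) ∣ ≤ k
    shrink a∉S size = ≤-pred (≤-trans (∣∁S∪⁅a⁆∣<∣∁S∣ a∉S) size)

    conn?-within : ∀ k S → ∣ ∁ S ∣ ≤ k → ∀ a b → Dec (Conn G S a b)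
    conn?-within k S size a b with a ∈? S
    ... | yes a∈S = no λ c → proj₁ c a∈S
    conn?-within zero S size a b | no a∉S = ⊥-elim (n≮0 (≤-trans (∣∁S∪⁅a⁆∣<∣∁S∣ a∉S) size))
    conn?-within (suc k) S size a b | no a∉S with a ≟ b
    ... | yes refl = yes (Conn-refl a∉S)
    ... | no a≢b with any? (λ c → adjacent? a c ×-dec conn?-within k (S ∪ ⁅ a ⁆) (shrink a∉S size) c b)
    ...   | yes (c , ac , c∉ , path) = yes (a∉S , (a∉S , ∉∪⁅⁆⇒∉ c∉ , ac) ◅ avoiding⇒Star path c∉)
    ...   | no ∄c = no λ (_ , path) → [ (λ (a≢a , _) → a≢a refl) , ∄c ]′ (last-visit (a≢b ∘ sym) path)

  conn? : ∀ S a b → Dec (Conn G S a b)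
  conn? S = conn?-within (nV G) S (∣p∣≤n (∁ S))

  module _ {S K : VSet G} (K-component : IsComponent G S K) where

    IsComponent-∉ : ∀ {v} → v ∈ K → v ∉ S
    IsComponent-∉ = proj₁ (proj₂ K-component) _

    IsComponent-connected : ∀ {u v} → u ∈ K → v ∈ K → Conn G S u v
    IsComponent-connected u∈K = proj₁ (proj₂ (proj₂ K-component) _ _ u∈K)

    IsComponent-closed : ∀ {u v} → u ∈ K → Conn G S u v → v ∈ K
    IsComponent-closed u∈K = proj₂ (proj₂ (proj₂ K-component) _ _ u∈K)

  component : VSet G → Vtx G → VSet G
  component S v = ⟦ conn? S v ⟧

  ∈component : ∀ {S v} → v ∉ S → v ∈ component S v
  ∈component {S} {v} v∉S = ∈⟦⟧⁺ (conn? S v) (Conn-refl v∉S)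

  component-isComponent : ∀ {S v} → v ∉ S → IsComponent G S (component S v)
  component-isComponent {S} {v} v∉S =
    (v , ∈component v∉S) ,
    (λ w w∈ → Conn-∉ʳ (∈⟦⟧⁻ (conn? S v) w∈)) ,
    λ u w u∈ → (λ w∈ → Conn-trans (Conn-sym (∈⟦⟧⁻ (conn? S v) u∈)) (∈⟦⟧⁻ (conn? S v) w∈)) ,
               (λ uw → ∈⟦⟧⁺ (conn? S v) (Conn-trans (∈⟦⟧⁻ (conn? S v) u∈) uw))

  IsComponent⇒≡component : ∀ {S K v} → IsComponent G S K → v ∈ K → K ≡ component S v
  IsComponent⇒≡component {S} {K} {v} K-component v∈K = ⊆-antisym
    (λ w∈K → ∈⟦⟧⁺ (conn? S v) (IsComponent-connected K-component v∈K w∈K))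
    (λ w∈ → IsComponent-closed K-component v∈K (∈⟦⟧⁻ (conn? S v) w∈))

  IsComponent-unique : ∀ {S K K′ v} → IsComponent G S K → IsComponent G S K′ → v ∈ K → v ∈ K′ → K ≡ K′
  IsComponent-unique K-component K′-component v∈K v∈K′ =
    trans (IsComponent⇒≡component K-component v∈K) (sym (IsComponent⇒≡component K′-component v∈K′))

  union-of-components-even : ∀ {T} → HasEvenComponents G T →
    ∀ {P} (P? : Decidable P) → (∀ {v} → P v → v ∉ T) → (∀ {v w} → Conn G T v w → P v → P w) →
    Even ∣ ⟦ P? ⟧ ∣
  union-of-components-even {T} components-even = ∣⟦⟧∣-induction UnionOfComponents step
    where
    UnionOfComponents : ∀ {P} → Decidable P → Set
    UnionOfComponents {P} P? = (∀ {v} → P v → v ∉ T) → (∀ {v w} → Conn G T v w → P v → P w) → Even ∣ ⟦ P? ⟧ ∣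
    step : ∀ {P} (P? : Decidable P) → (∀ {P′} (P′? : Decidable P′) → ∣ ⟦ P′? ⟧ ∣ < ∣ ⟦ P? ⟧ ∣ → UnionOfComponents P′?) →
      UnionOfComponents P?
    step P? ih avoids closed with any? P?
    ... | no ∄P = subst Even (sym (∣⟦⟧∣≡0 P? λ x px → ∄P (x , px))) refl
    ... | yes (x , px) = subst Even (sym split)
          (even+even⇒even {∣ ⟦ C? ⟧ ∣} {∣ ⟦ R? ⟧ ∣} C-even
            (ih R? R<P (avoids ∘ proj₁) λ vw (pv , ¬xv) → closed vw pv , λ xw → ¬xv (Conn-trans xw (Conn-sym vw))))
      where
      C? = P? ∩? conn? T x
      R? = P? ∩? ∁? (conn? T x)
      split = ∣⟦⟧∣-split P? (conn? T x)
      C-even : Even ∣ ⟦ C? ⟧ ∣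
      C-even = subst (Even ∘ ∣_∣) (⟦⟧-cong (conn? T x) C? (λ xv → closed xv px , xv) proj₂)
                 (components-even _ (component-isComponent (avoids px)))
      R<P : ∣ ⟦ R? ⟧ ∣ < ∣ ⟦ P? ⟧ ∣
      R<P = subst (∣ ⟦ R? ⟧ ∣ <_) (sym split) (m<n+m ∣ ⟦ R? ⟧ ∣ (∣⟦⟧∣>0 C? (px , Conn-refl (avoids px))))

  -- Perfect matchings

  Joins⇒Incidentˡ : ∀ {e a b} → Joins G e a b → Incident G a e
  Joins⇒Incidentˡ (inj₁ refl) = inj₁ refl
  Joins⇒Incidentˡ (inj₂ refl) = inj₂ refl

  Joins-functional : ∀ {e a b c} → Joins G e a b → Joins G e a c → b ≡ c
  Joins-functional (inj₁ p) (inj₁ q) = ,-injectiveʳ (trans (sym p) q)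
  Joins-functional (inj₂ p) (inj₂ q) = proj₁ (,-injective (trans (sym p) q))
  Joins-functional {e} (inj₁ p) (inj₂ q) = ⊥-elim (loopless G e (trans (cong proj₁ p) (sym (cong proj₂ q))))
  Joins-functional {e} (inj₂ p) (inj₁ q) = ⊥-elim (loopless G e (trans (cong proj₁ q) (sym (cong proj₂ p))))

  other-end : Fin (nE G) → Vtx G → Vtx G
  other-end e v with proj₁ (ends G e) ≟ v
  ... | yes _ = proj₂ (ends G e)
  ... | no _ = proj₁ (ends G e)

  other-end-joins : ∀ {e v} → Incident G v e → Joins G e v (other-end e v)
  other-end-joins {e} {v} v∈e with proj₁ (ends G e) ≟ v | v∈e
  ... | yes first≡v | _ = inj₁ (×-≡,≡→≡ (first≡v , refl))
  ... | no first≢v | inj₁ first≡v = ⊥-elim (first≢v first≡v)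
  ... | no _ | inj₂ second≡v = inj₂ (×-≡,≡→≡ (refl , second≡v))

  module PerfectMatching {M : Subset (nE G)} (M-perfect : IsPerfectMatching G M) where

    matched : Vtx G → Fin (nE G)
    matched v = proj₁ (M-perfect v)

    mate : Vtx G → Vtx G
    mate v = other-end (matched v) v

    mate-joins : ∀ v → Joins G (matched v) v (mate v)
    mate-joins v = other-end-joins (proj₁ (proj₂ (proj₂ (M-perfect v))))

    mate-of-edge : ∀ {e x y} → e ∈ M → Joins G e x y → mate x ≡ y
    mate-of-edge {e} {x} e∈M xy with proj₂ (proj₂ (proj₂ (M-perfect x))) e e∈M (Joins⇒Incidentˡ xy)
    ... | refl = Joins-functional (mate-joins x) xy

    mate-mate : ∀ v → mate (mate v) ≡ v
    mate-mate v = mate-of-edge (proj₁ (proj₂ (M-perfect v))) (Joins-sym (mate-joins v))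

    mate≢ : ∀ v → mate v ≢ v
    mate≢ v = Joins⇒≢ (mate-joins v) ∘ sym

  -- Every component C of G − {t, t′} sees t: otherwise take an edge x t′ leaving C and a perfect
  -- matching through it; the mate map is then an involution of C − x, so C would be odd.
  component-adjacent-to-separator : IsMatchingCovered G →
    ∀ {T t t′} → T ≡ ⁅ t ⁆ ∪ ⁅ t′ ⁆ → t ≢ t′ → HasEvenComponents G T →
    ∀ {b} → b ∉ T → ∃ λ b′ → Conn G T b b′ × Adjacent b′ t
  component-adjacent-to-separator (connected , _ , perfect-matching-through) {T} {t} {t′} refl t≢t′ components-even
    {b} b∉T
    with any? (λ b′ → conn? T b b′ ×-dec adjacent? b′ t)
       | Star-exit (conn? T b) (proj₂ (connected b t)) (Conn-refl b∉T) (λ bt → Conn-∉ʳ bt a∈⁅a⁆∪⁅b⁆)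
  ... | yes found | _ = found
  ... | no ∄b′ | x , y , bx , (_ , _ , e , xy) , ¬by = ⊥-elim (even⇒¬odd {∣ ⟦ C? ⟧ ∣} C-even C-odd)
    where
    x∉T = Conn-∉ʳ bx
    y≡t′ : y ≡ t′
    y≡t′ with y ∈? T
    ... | no y∉T = ⊥-elim (¬by (Conn-trans bx (Step⇒Conn (x∉T , y∉T , e , xy))))
    ... | yes y∈T = [ (λ { refl → ⊥-elim (∄b′ (x , bx , e , xy)) }) , (λ y≡t′ → y≡t′) ]′ (∈⁅⁆∪⁅⁆⁻ y∈T)
    M = perfect-matching-through e
    open PerfectMatching (proj₁ (proj₂ M))
    mate-x : mate x ≡ y
    mate-x = mate-of-edge (proj₂ (proj₂ M)) xy
    mate-y : mate y ≡ x
    mate-y = mate-of-edge (proj₂ (proj₂ M)) (Joins-sym xy)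
    C? = conn? T b
    C-x? = C? ∩? ∁? (_≟ x)
    closed : ∀ {v} → Conn G T b v × v ≢ x → Conn G T b (mate v) × mate v ≢ x
    closed {v} (bv , v≢x) = Conn-trans bv (Step⇒Conn (Conn-∉ʳ bv , mate∉T , matched v , mate-joins v)) , mate≢x
      where
      mate∉T : mate v ∉ T
      mate∉T = ∉⁅⁆∪⁅⁆
        (λ mate≡t → ∄b′ (v , bv , matched v , subst (Joins G (matched v) v) mate≡t (mate-joins v)))
        (λ mate≡t′ → v≢x (trans (sym (mate-mate v)) (trans (cong mate (trans mate≡t′ (sym y≡t′))) mate-y)))
      mate≢x : mate v ≢ x
      mate≢x mate≡x = Conn-∉ʳ bv (subst (_∈ T) (sym v≡t′) b∈⁅a⁆∪⁅b⁆)
        where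
        v≡t′ : v ≡ t′
        v≡t′ = trans (sym (mate-mate v)) (trans (cong mate mate≡x) (trans mate-x y≡t′))
    C-even : Even ∣ ⟦ C? ⟧ ∣
    C-even = components-even _ (component-isComponent b∉T)
    C-odd : Odd ∣ ⟦ C? ⟧ ∣
    C-odd = subst Odd (sym (∣⟦⟧∣-remove C? bx))
      (even⇒odd-suc {∣ ⟦ C-x? ⟧ ∣} (involution⇒∣⟦⟧∣-even C-x? mate closed (λ _ → mate≢ _) (λ _ → mate-mate _)))

-- Contracting the complement of X

module Contraction
  (G : Graph) (G-matchingCovered : IsMatchingCovered G) (X : VSet G) (u1 u2 : Vtx G) (cut : IsTwoSepCut G X u1 u2)
  (H : Graph) (xbar : Vtx H) (ι : Vtx G → Vtx H) (contraction : IsContraction G X H xbar ι) where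

  open IsContraction contraction

  T : VSet G
  T = ⁅ u1 ⁆ ∪ ⁅ u2 ⁆

  u1≢u2 : u1 ≢ u2
  u1≢u2 = proj₁ (proj₁ cut)

  T-components-even : HasEvenComponents G T
  T-components-even = proj₂ (proj₂ (proj₁ cut))

  u1∈X : u1 ∈ X
  u1∈X = proj₁ (proj₂ cut)

  u2∉X : u2 ∉ X
  u2∉X = proj₁ (proj₂ (proj₂ cut))

  X-closed : ∀ {a b} → Conn G T a b → a ∈ X → b ∈ X
  X-closed = proj₁ (proj₂ (proj₂ (proj₂ cut))) _ _

  ι-u2 : ι u2 ≡ xbar
  ι-u2 = outside u2 u2∉X

  -- The vertices of G that stand for the vertices of H: X, and u2 for xbar.
  Rep : Vtx G → Set
  Rep v = v ∈ X ⊎ v ≡ u2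

  Rep? : Decidable Rep
  Rep? v = (v ∈? X) ⊎-dec (v ≟ u2)

  ¬Rep⇒∉T : ∀ {v} → ¬ Rep v → v ∉ T
  ¬Rep⇒∉T ¬rep = ∉⁅⁆∪⁅⁆ (λ { refl → ¬rep (inj₁ u1∈X) }) (¬rep ∘ inj₂)

  ¬Rep-closed : ∀ {v w} → Step G T v w → ¬ Rep v → ¬ Rep w
  ¬Rep-closed st@(_ , w∉T , _) ¬rep-v (inj₁ w∈X) = ¬rep-v (inj₁ (X-closed (Conn-sym G (Step⇒Conn G st)) w∈X))
  ¬Rep-closed (_ , w∉T , _) _ (inj₂ refl) = w∉T b∈⁅a⁆∪⁅b⁆

  ι-injective-on-Rep : ∀ {v w} → Rep v → Rep w → ι v ≡ ι w → v ≡ w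
  ι-injective-on-Rep (inj₁ v∈X) (inj₁ w∈X) eq = injX _ _ v∈X w∈X eq
  ι-injective-on-Rep (inj₁ v∈X) (inj₂ refl) eq = ⊥-elim (inside _ v∈X (trans eq ι-u2))
  ι-injective-on-Rep (inj₂ refl) (inj₁ w∈X) eq = ⊥-elim (inside _ w∈X (trans (sym eq) ι-u2))
  ι-injective-on-Rep (inj₂ refl) (inj₂ refl) eq = refl

  rep : Vtx H → Vtx G
  rep y with y ≟ xbar
  ... | yes _ = u2
  ... | no _ = proj₁ (surj y)

  ι∘rep : ∀ y → ι (rep y) ≡ y
  ι∘rep y with y ≟ xbar
  ... | yes refl = ι-u2
  ... | no _ = proj₂ (surj y)

  rep-Rep : ∀ y → Rep (rep y)
  rep-Rep y with y ≟ xbar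
  ... | yes _ = inj₂ refl
  ... | no y≢xbar with proj₁ (surj y) ∈? X
  ...   | yes v∈X = inj₁ v∈X
  ...   | no v∉X = ⊥-elim (y≢xbar (trans (sym (proj₂ (surj y))) (outside _ v∉X)))

  rep-unique : ∀ {y w} → Rep w → ι w ≡ y → rep y ≡ w
  rep-unique {y} rep-w ιw≡y = ι-injective-on-Rep (rep-Rep y) rep-w (trans (ι∘rep y) (sym ιw≡y))

  rep∘ι : ∀ {v} → Rep v → rep (ι v) ≡ v
  rep∘ι rep-v = rep-unique rep-v refl

  ψ-joins : ∀ {h a b} → Joins G (ψ h) a b → Joins H h (ι a) (ι b)
  ψ-joins {h} (inj₁ eq) = inj₁ (trans (ψ-ends h) (cong (λ (a , b) → ι a , ι b) eq))
  ψ-joins {h} (inj₂ eq) = inj₂ (trans (ψ-ends h) (cong (λ (a , b) → ι a , ι b) eq))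

  ι-adjacent : ∀ {a b} → Adjacent G a b → a ∈ X ⊎ b ∈ X → Adjacent H (ι a) (ι b)
  ι-adjacent (e , ab) touches-X with ψ-image e (ends-touch ab touches-X)
    where
    ends-touch : ∀ {e a b} → Joins G e a b → a ∈ X ⊎ b ∈ X → proj₁ (ends G e) ∈ X ⊎ proj₂ (ends G e) ∈ X
    ends-touch (inj₁ eq) = subst (λ (x , y) → x ∈ X ⊎ y ∈ X) (sym eq)
    ends-touch (inj₂ eq) = subst (λ (x , y) → x ∈ X ⊎ y ∈ X) (sym eq) ∘ Data.Sum.swap
  ... | h , refl = h , ψ-joins ab

  adjacent-lift : ∀ {p q} → Adjacent H p q → ∃ λ a → ∃ λ b → Adjacent G a b × ι a ≡ p × ι b ≡ q
  adjacent-lift (h , pq) with ψ-ends h | pq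
  ... | eq | inj₁ pq-eq = _ , _ , (ψ h , inj₁ refl) , ,-injective (trans (sym eq) pq-eq)
  ... | eq | inj₂ qp-eq = _ , _ , (ψ h , inj₂ refl) , Data.Product.swap (,-injective (trans (sym eq) qp-eq))

  u1-outside-neighbour : ∃ λ w → w ∉ X × Adjacent G u1 w
  u1-outside-neighbour with proj₂ (proj₂ (proj₂ (proj₂ (proj₂ cut))))
  ... | b , b∉T , b∉X with component-adjacent-to-separator G G-matchingCovered refl u1≢u2 T-components-even b∉T
  ...   | b′ , bb′ , b′u1 = b′ , (λ b′∈X → b∉X (X-closed (Conn-sym G bb′) b′∈X)) , Adjacent-sym G b′u1

  outside-adjacent-to-u2 : ∀ {b} → b ∉ T → ∃ λ b′ → Conn G T b b′ × Adjacent G b′ u2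
  outside-adjacent-to-u2 =
    component-adjacent-to-separator G G-matchingCovered (∪-comm ⁅ u1 ⁆ ⁅ u2 ⁆) (u1≢u2 ∘ sym) T-components-even

  module Lift (SH : VSet H) where

    S : VSet G
    S = liftSet G H X xbar ι u2 SH

    ∈S⁻ : ∀ {v} → v ∈ S → Rep v × ι v ∈ SH
    ∈S⁻ {v} v∈S with lookup X v in X[v] | trans (sym (lookup∘tabulate _ v)) ([]=⇒lookup v∈S)
    ... | true | SH[ιv] = inj₁ (lookup⇒[]= v X X[v]) , lookup⇒[]= (ι v) SH SH[ιv]
    ... | false | _ with v ≟ u2 | lookup SH xbar in SH[xbar]
    ...   | yes refl | true = inj₂ refl , subst (_∈ SH) (sym ι-u2) (lookup⇒[]= xbar SH SH[xbar])
    ∈S⁻ _ | false | () | yes refl | false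
    ∈S⁻ _ | false | () | no _ | _

    ∈S⁺ : ∀ {v} → Rep v → ι v ∈ SH → v ∈ S
    ∈S⁺ {v} rep-v ιv∈SH = lookup⇒[]= v S (trans (lookup∘tabulate _ v) (S[v] rep-v))
      where
      S[v] : Rep v → (if lookup X v then lookup SH (ι v) else (⌊ v ≟ u2 ⌋ ∧ lookup SH xbar)) ≡ true
      S[v] (inj₁ v∈X) rewrite []=⇒lookup v∈X = []=⇒lookup ιv∈SH
      S[v] (inj₂ refl) with lookup X u2 in X[u2] | u2 ≟ u2
      ... | true | _ = ⊥-elim (u2∉X (lookup⇒[]= u2 X X[u2]))
      ... | false | no u2≢u2 = ⊥-elim (u2≢u2 refl)
      ... | false | yes _ = []=⇒lookup (subst (_∈ SH) ι-u2 ιv∈SH)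

    ι-∉SH : ∀ {v} → Rep v → v ∉ S → ι v ∉ SH
    ι-∉SH rep-v v∉S = v∉S ∘ ∈S⁺ rep-v

    ∉SH⇒∉S : ∀ {v} → ι v ∉ SH → v ∉ S
    ∉SH⇒∉S ιv∉SH = ιv∉SH ∘ proj₂ ∘ ∈S⁻

    rep-∉S : ∀ {y} → y ∉ SH → rep y ∉ S
    rep-∉S {y} y∉SH = ∉SH⇒∉S (subst (_∉ SH) (sym (ι∘rep y)) y∉SH)

    ¬Rep⇒∉S : ∀ {v} → ¬ Rep v → v ∉ S
    ¬Rep⇒∉S ¬rep-v = ¬rep-v ∘ proj₁ ∘ ∈S⁻

    rep∈S : ∀ {y} → y ∈ SH → rep y ∈ S
    rep∈S {y} y∈SH = ∈S⁺ (rep-Rep y) (subst (_∈ SH) (sym (ι∘rep y)) y∈SH)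

    u2∈S : xbar ∈ SH → u2 ∈ S
    u2∈S xbar∈SH = ∈S⁺ (inj₂ refl) (subst (_∈ SH) (sym ι-u2) xbar∈SH)

    u2∉S : xbar ∉ SH → u2 ∉ S
    u2∉S xbar∉SH = ∉SH⇒∉S (subst (_∉ SH) (sym ι-u2) xbar∉SH)

    Star-T⇒Star-S : ∀ {v w} → Star (Step G T) v w → ¬ Rep v → Star (Step G S) v w × ¬ Rep w
    Star-T⇒Star-S path ¬rep-v =
      Star-restrict G (¬_ ∘ Rep) ¬Rep⇒∉S ¬Rep-closed path ¬rep-v , Star-preserves (¬_ ∘ Rep) ¬Rep-closed path ¬rep-v

    -- Either b = u2, or b lies in a component of G − T, which sees u2 and avoids S.
    Conn-u2 : ∀ {a b} → a ∈ X → b ∉ X → Adjacent G a b → a ∉ S → xbar ∉ SH → Conn G S a u2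
    Conn-u2 {a} {b} a∈X b∉X ab a∉S xbar∉SH with b ≟ u2
    ... | yes refl = Step⇒Conn G (a∉S , u2∉S xbar∉SH , ab)
    ... | no b≢u2 with outside-adjacent-to-u2 (¬Rep⇒∉T ¬rep-b) | ¬rep-b
      where ¬rep-b = [ b∉X , b≢u2 ]′
    ...   | b′ , (_ , b⇝b′) , b′u2 | ¬rep-b with Star-T⇒Star-S b⇝b′ ¬rep-b
    ...     | b⇝b′ˢ , ¬rep-b′ =
      a∉S , (a∉S , ¬Rep⇒∉S ¬rep-b , ab) ◅ b⇝b′ˢ ◅◅ (¬Rep⇒∉S ¬rep-b′ , u2∉S xbar∉SH , b′u2) ◅ ε

    lift-crossing : ∀ {a b} → a ∈ X → b ∉ X → Adjacent G a b → ι a ∉ SH → ι b ∉ SH → Conn G S (rep (ι a)) (rep (ι b))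
    lift-crossing {a} {b} a∈X b∉X ab ιa∉SH ιb∉SH =
      subst₂ (Conn G S) (sym (rep∘ι (inj₁ a∈X))) (sym (rep-unique (inj₂ refl) (trans ι-u2 (sym (outside b b∉X)))))
        (Conn-u2 a∈X b∉X ab (∉SH⇒∉S ιa∉SH) (subst (_∉ SH) (outside b b∉X) ιb∉SH))

    lift-adjacent : ∀ {a b} → Adjacent G a b → ι a ∉ SH → ι b ∉ SH → Conn G S (rep (ι a)) (rep (ι b))
    lift-adjacent {a} {b} ab ιa∉SH ιb∉SH with a ∈? X | b ∈? X
    ... | yes a∈X | yes b∈X = subst₂ (Conn G S) (sym (rep∘ι (inj₁ a∈X))) (sym (rep∘ι (inj₁ b∈X)))
                                (Step⇒Conn G (∉SH⇒∉S ιa∉SH , ∉SH⇒∉S ιb∉SH , ab))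
    ... | yes a∈X | no b∉X = lift-crossing a∈X b∉X ab ιa∉SH ιb∉SH
    ... | no a∉X | yes b∈X = Conn-sym G (lift-crossing b∈X a∉X (Adjacent-sym G ab) ιb∉SH ιa∉SH)
    ... | no a∉X | no b∉X = subst (λ y → Conn G S (rep (ι a)) (rep y)) (trans (outside a a∉X) (sym (outside b b∉X)))
                              (Conn-refl G (rep-∉S ιa∉SH))

    lift-Step : ∀ {p q} → Step H SH p q → Conn G S (rep p) (rep q)
    lift-Step (p∉SH , q∉SH , pq) with adjacent-lift pq
    ... | a , b , ab , refl , refl = lift-adjacent ab p∉SH q∉SH

    lift-Conn : ∀ {y z} → Conn H SH y z → Conn G S (rep y) (rep z)
    lift-Conn (y∉SH , path) = lift-Star y∉SH path
      where
      lift-Star : ∀ {y z} → y ∉ SH → Star (Step H SH) y z → Conn G S (rep y) (rep z)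
      lift-Star y∉SH ε = Conn-refl G (rep-∉S y∉SH)
      lift-Star _ (st@(_ , q∉SH , _) ◅ path) = Conn-trans G (lift-Step st) (lift-Star q∉SH path)

    -- If xbar ∈ SH then u2 ∈ S, so a path of G − S passes between X and its complement only
    -- through u1; its excursions outside X are then collapsed onto ι u1 rather than onto xbar.
    outside-shadow : Vtx H
    outside-shadow with xbar ∈? SH
    ... | yes _ = ι u1
    ... | no _ = xbar

    shadow : Vtx G → Vtx H
    shadow v with v ∈? X
    ... | yes _ = ι v
    ... | no _ = outside-shadow

    crossing-shadow : ∀ {a b} → Step G S a b → a ∈ X → b ∉ X → ι a ≡ outside-shadow ⊎ Step H SH (ι a) outside-shadow
    crossing-shadow {a} {b} (a∉S , b∉S , ab) a∈X b∉X with xbar ∈? SH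
    ... | no xbar∉SH = inj₂ (ι-∉SH (inj₁ a∈X) a∉S , xbar∉SH ,
                             subst (Adjacent H (ι a)) (outside b b∉X) (ι-adjacent ab (inj₁ a∈X)))
    ... | yes xbar∈SH with a ≟ u1 | b ≟ u2
    ...   | yes refl | _ = inj₁ refl
    ...   | no _ | yes refl = ⊥-elim (b∉S (u2∈S xbar∈SH))
    ...   | no a≢u1 | no b≢u2 = ⊥-elim (b∉X (X-closed (Step⇒Conn G (a∉T , b∉T , ab)) a∈X))
      where
      a∉T = ∉⁅⁆∪⁅⁆ a≢u1 (λ { refl → u2∉X a∈X })
      b∉T = ∉⁅⁆∪⁅⁆ (λ { refl → b∉X u1∈X }) b≢u2

    shadow-Step : ∀ {a b} → Step G S a b → shadow a ≡ shadow b ⊎ Step H SH (shadow a) (shadow b)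
    shadow-Step {a} {b} st@(a∉S , b∉S , ab) with a ∈? X | b ∈? X
    ... | yes a∈X | yes b∈X = inj₂ (ι-∉SH (inj₁ a∈X) a∉S , ι-∉SH (inj₁ b∈X) b∉S , ι-adjacent ab (inj₁ a∈X))
    ... | yes a∈X | no b∉X = crossing-shadow st a∈X b∉X
    ... | no a∉X | yes b∈X = Data.Sum.map sym (Step-sym H) (crossing-shadow (Step-sym G st) b∈X a∉X)
    ... | no _ | no _ = inj₁ refl

    project : ∀ {a b} → Conn G S a b → shadow a ∉ SH → Conn H SH (shadow a) (shadow b)
    project (_ , path) shadow-a∉SH = shadow-a∉SH , project-Star path
      where
      project-Star : ∀ {a b} → Star (Step G S) a b → Star (Step H SH) (shadow a) (shadow b)
      project-Star ε = ε
      project-Star (st ◅ path) with shadow-Step st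
      ... | inj₁ same = subst (λ y → Star (Step H SH) y _) (sym same) (project-Star path)
      ... | inj₂ step = step ◅ project-Star path

    shadow-rep : ∀ {y} → rep y ∉ S → shadow (rep y) ≡ y
    shadow-rep {y} rep-y∉S with rep y ∈? X | rep-Rep y | ι∘rep y
    ... | yes _ | _ | ι-rep-y = ι-rep-y
    ... | no rep-y∉X | inj₁ rep-y∈X | _ = ⊥-elim (rep-y∉X rep-y∈X)
    ... | no _ | inj₂ rep-y≡u2 | ι-rep-y with xbar ∈? SH
    ...   | yes xbar∈SH = ⊥-elim (rep-y∉S (subst (_∈ S) (sym rep-y≡u2) (u2∈S xbar∈SH)))
    ...   | no _ = trans (sym ι-u2) (trans (cong ι (sym rep-y≡u2)) ι-rep-y)

    shadow-outside : ∀ {v} → v ∉ X → shadow v ≡ xbar ⊎ shadow v ≡ ι u1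
    shadow-outside {v} v∉X with v ∈? X
    ... | yes v∈X = ⊥-elim (v∉X v∈X)
    ... | no _ with xbar ∈? SH
    ...   | yes _ = inj₂ refl
    ...   | no _ = inj₁ refl

    project-rep : ∀ {y v} → Conn G S (rep y) v → Conn H SH y (shadow v)
    project-rep {y} {v} c@(rep-y∉S , _) = subst (λ z → Conn H SH z (shadow v)) (shadow-rep {y} rep-y∉S)
      (project c (subst (_∉ SH) (sym (shadow-rep {y} rep-y∉S)) y∉SH))
      where
      y∉SH : y ∉ SH
      y∉SH = subst (_∉ SH) (ι∘rep y) (ι-∉SH (rep-Rep y) rep-y∉S)

    project-Conn : ∀ {y z} → Conn G S (rep y) (rep z) → Conn H SH y z
    project-Conn {y} {z} c = subst (Conn H SH y) (shadow-rep {z} (Conn-∉ʳ G c)) (project-rep c)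

    LiftedFrom : VSet H → Vtx G → Set
    LiftedFrom K v = ∃ λ y → y ∈ K × Conn G S (rep y) v

    liftedFrom? : ∀ K → Decidable (LiftedFrom K)
    liftedFrom? K v = any? λ y → (y ∈? K) ×-dec conn? G S (rep y) v

    liftComponent : VSet H → VSet G
    liftComponent K = ⟦ liftedFrom? K ⟧

    module _ {K : VSet H} (K-component : IsComponent H SH K) where

      rep∈liftComponent : ∀ {y} → y ∈ K → rep y ∈ liftComponent K
      rep∈liftComponent y∈K = ∈⟦⟧⁺ (liftedFrom? K) (_ , y∈K , Conn-refl G (rep-∉S (IsComponent-∉ H K-component y∈K)))

      liftComponent-isComponent : IsComponent G S (liftComponent K)
      liftComponent-isComponent =
        (_ , rep∈liftComponent (proj₂ (proj₁ K-component))) ,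
        (λ v v∈ → Conn-∉ʳ G (proj₂ (proj₂ (∈⟦⟧⁻ (liftedFrom? K) v∈)))) ,
        λ u v u∈ → (λ v∈ → connected (∈⟦⟧⁻ (liftedFrom? K) u∈) (∈⟦⟧⁻ (liftedFrom? K) v∈)) ,
                   (λ uv → closed (∈⟦⟧⁻ (liftedFrom? K) u∈) uv)
        where
        connected : ∀ {u v} → LiftedFrom K u → LiftedFrom K v → Conn G S u v
        connected (y , y∈K , yu) (z , z∈K , zv) =
          Conn-trans G (Conn-sym G yu) (Conn-trans G (lift-Conn (IsComponent-connected H K-component y∈K z∈K)) zv)
        closed : ∀ {u v} → LiftedFrom K u → Conn G S u v → v ∈ liftComponent K
        closed (y , y∈K , yu) uv = ∈⟦⟧⁺ (liftedFrom? K) (y , y∈K , Conn-trans G yu uv)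

      liftComponent-Rep : ∀ {v} → Rep v → v ∈ liftComponent K → ι v ∈ K
      liftComponent-Rep rep-v v∈ with ∈⟦⟧⁻ (liftedFrom? K) v∈
      ... | y , y∈K , yv =
        IsComponent-closed H K-component y∈K (project-Conn (subst (Conn G S (rep y)) (sym (rep∘ι rep-v)) yv))

      liftComponent-¬Rep : ∀ {v} → ¬ Rep v → v ∈ liftComponent K → xbar ∈ K ⊎ ι u1 ∈ K
      liftComponent-¬Rep {v} ¬rep-v v∈ with ∈⟦⟧⁻ (liftedFrom? K) v∈
      ... | y , y∈K , yv = Data.Sum.map (λ eq → subst (_∈ K) eq shadow-v∈K) (λ eq → subst (_∈ K) eq shadow-v∈K)
                             (shadow-outside (¬rep-v ∘ inj₁))
        where
        shadow-v∈K : shadow v ∈ K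
        shadow-v∈K = IsComponent-closed H K-component y∈K (project-rep yv)

      ∣liftComponent∩Rep∣≡∣K∣ : ∣ ⟦ (_∈? liftComponent K) ∩? Rep? ⟧ ∣ ≡ ∣ K ∣
      ∣liftComponent∩Rep∣≡∣K∣ = trans
        (∣⟦⟧∣-bijection ((_∈? liftComponent K) ∩? Rep?) (_∈? K) ι rep
          (λ (v∈ , rep-v) → liftComponent-Rep rep-v v∈) (λ {y} y∈K → rep∈liftComponent y∈K , rep-Rep y)
          (λ (_ , rep-v) → rep∘ι rep-v) (λ {y} _ → ι∘rep y))
        (cong ∣_∣ (⟦∈?⟧ K))

    ¬Rep-part-even : ∀ {L} → IsComponent G S L → Even ∣ ⟦ (_∈? L) ∩? ∁? Rep? ⟧ ∣
    ¬Rep-part-even {L} L-component = union-of-components-even G T-components-even ((_∈? L) ∩? ∁? Rep?)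
      (¬Rep⇒∉T ∘ proj₂) closed
      where
      closed : ∀ {v w} → Conn G T v w → v ∈ L × ¬ Rep v → w ∈ L × ¬ Rep w
      closed (_ , path) (v∈L , ¬rep-v) with Star-T⇒Star-S path ¬rep-v
      ... | pathˢ , ¬rep-w = IsComponent-closed G L-component v∈L (¬Rep⇒∉S ¬rep-v , pathˢ) , ¬rep-w

    ∣L∣≡∣L∩Rep∣+even : ∀ {L} → IsComponent G S L → ∃ λ m → Even m × ∣ L ∣ ≡ ∣ ⟦ (_∈? L) ∩? Rep? ⟧ ∣ + m
    ∣L∣≡∣L∩Rep∣+even {L} L-component =
      _ , ¬Rep-part-even L-component , trans (cong ∣_∣ (sym (⟦∈?⟧ L))) (∣⟦⟧∣-split (_∈? L) Rep?)

    module _ {K : VSet H} (K-component : IsComponent H SH K) where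

      ∣liftComponent∣≡∣K∣+even : ∃ λ m → Even m × ∣ liftComponent K ∣ ≡ ∣ K ∣ + m
      ∣liftComponent∣≡∣K∣+even with ∣L∣≡∣L∩Rep∣+even (liftComponent-isComponent K-component)
      ... | m , m-even , eq = m , m-even , trans eq (cong (_+ m) (∣liftComponent∩Rep∣≡∣K∣ K-component))

      liftComponent-even : Even ∣ K ∣ → Even ∣ liftComponent K ∣
      liftComponent-even K-even with ∣liftComponent∣≡∣K∣+even
      ... | m , m-even , eq = subst Even (sym eq) (even+even⇒even {∣ K ∣} {m} K-even m-even)

      liftComponent-odd : Odd ∣ K ∣ → Odd ∣ liftComponent K ∣
      liftComponent-odd K-odd with ∣liftComponent∣≡∣K∣+even
      ... | m , m-even , eq = subst Odd (sym eq) (odd+even⇒odd {∣ K ∣} {m} K-odd m-even)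

    liftComponent-injective : ∀ {K K′} → IsComponent H SH K → IsComponent H SH K′ →
      liftComponent K ≡ liftComponent K′ → K ≡ K′
    liftComponent-injective K-component K′-component eq with proj₁ K-component
    ... | y , y∈K = IsComponent-unique H K-component K′-component y∈K
      (subst (_∈ _) (ι∘rep y) (liftComponent-Rep K′-component (rep-Rep y)
        (subst (rep y ∈_) eq (rep∈liftComponent K-component y∈K))))

    -- A component of G − S without vertices of Rep is a union of (even) components of G − T.
    component-classification : ∀ {L} → IsComponent G S L →
      (∃ λ K → IsComponent H SH K × liftComponent K ≡ L) ⊎ Even ∣ L ∣
    component-classification {L} L-component with any? (λ v → (v ∈? L) ×-dec Rep? v)
    ... | yes (v , v∈L , rep-v) =
      inj₁ (K , K-component , IsComponent-unique G (liftComponent-isComponent K-component) L-component v∈liftK v∈L)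
      where
      ιv∉SH = ι-∉SH rep-v (IsComponent-∉ G L-component v∈L)
      K = component H SH (ι v)
      K-component = component-isComponent H ιv∉SH
      v∈liftK = subst (_∈ liftComponent K) (rep∘ι rep-v) (rep∈liftComponent K-component (∈component H ιv∉SH))
    ... | no ∄v with ∣L∣≡∣L∩Rep∣+even L-component
    ...   | m , m-even , eq = inj₂ (subst Even (sym (trans eq (cong (_+ m) L∩Rep≡0))) m-even)
      where
      L∩Rep≡0 : ∣ ⟦ (_∈? L) ∩? Rep? ⟧ ∣ ≡ 0
      L∩Rep≡0 = ∣⟦⟧∣≡0 ((_∈? L) ∩? Rep?) (λ v v∈ → ∄v (v , v∈))

    ∣S∣≡∣SH∣ : ∣ S ∣ ≡ ∣ SH ∣
    ∣S∣≡∣SH∣ = begin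
      ∣ S ∣              ≡⟨ cong ∣_∣ (sym (⟦∈?⟧ S)) ⟩
      ∣ ⟦ _∈? S ⟧ ∣      ≡⟨ ∣⟦⟧∣-bijection (_∈? S) (_∈? SH) ι rep
                              (proj₂ ∘ ∈S⁻) rep∈S (rep∘ι ∘ proj₁ ∘ ∈S⁻) (λ {y} _ → ι∘rep y) ⟩
      ∣ ⟦ _∈? SH ⟧ ∣     ≡⟨ cong ∣_∣ (⟦∈?⟧ SH) ⟩
      ∣ SH ∣             ∎
      where open ≡-Reasoning

    OddComponentCount-lift : ∀ {k} → OddComponentCount H SH k → OddComponentCount G S k
    OddComponentCount-lift (f , f-injective , f-odd , f-covers) =
      liftComponent ∘ f ,
      (λ eq → f-injective (liftComponent-injective (f-component _) (f-component _) eq)) ,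
      (λ i → liftComponent-isComponent (f-component i) , liftComponent-odd (f-component i) (proj₂ (f-odd i))) ,
      covers
      where
      f-component = proj₁ ∘ f-odd
      covers : ∀ L → IsComponent G S L → Odd ∣ L ∣ → ∃ λ i → liftComponent (f i) ≡ L
      covers L L-component L-odd with component-classification L-component
      ... | inj₂ L-even = ⊥-elim (even⇒¬odd {∣ L ∣} L-even L-odd)
      ... | inj₁ (K , K-component , refl) with even⊎odd ∣ K ∣
      ...   | inj₁ K-even = ⊥-elim (even⇒¬odd {∣ L ∣} (liftComponent-even K-component K-even) L-odd)
      ...   | inj₂ K-odd with f-covers K K-component K-odd
      ...     | i , refl = i , refl

    IsBarrier-lift : IsBarrier H SH → IsBarrier G S
    IsBarrier-lift ((y , y∈SH) , count) =
      (rep y , rep∈S y∈SH) ,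
      subst (OddComponentCount G S) (sym ∣S∣≡∣SH∣) (OddComponentCount-lift count)

    rep-pair : ∀ {p q} → SH ≡ ⁅ p ⁆ ∪ ⁅ q ⁆ → S ≡ ⁅ rep p ⁆ ∪ ⁅ rep q ⁆
    rep-pair {p} {q} SH≡ = ⊆-antisym to from
      where
      to : ∀ {v} → v ∈ S → v ∈ ⁅ rep p ⁆ ∪ ⁅ rep q ⁆
      to {v} v∈S with ∈S⁻ v∈S
      ... | rep-v , ιv∈SH with ∈⁅⁆∪⁅⁆⁻ (subst (ι v ∈_) SH≡ ιv∈SH)
      ...   | inj₁ ιv≡p = subst (_∈ ⁅ rep p ⁆ ∪ ⁅ rep q ⁆) (rep-unique rep-v ιv≡p) a∈⁅a⁆∪⁅b⁆
      ...   | inj₂ ιv≡q = subst (_∈ ⁅ rep p ⁆ ∪ ⁅ rep q ⁆) (rep-unique rep-v ιv≡q) b∈⁅a⁆∪⁅b⁆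
      from : ∀ {v} → v ∈ ⁅ rep p ⁆ ∪ ⁅ rep q ⁆ → v ∈ S
      from v∈ with ∈⁅⁆∪⁅⁆⁻ v∈
      ... | inj₁ refl = rep∈S (subst (p ∈_) (sym SH≡) a∈⁅a⁆∪⁅b⁆)
      ... | inj₂ refl = rep∈S (subst (q ∈_) (sym SH≡) b∈⁅a⁆∪⁅b⁆)

    Disconnects-lift : Disconnects H SH → Disconnects G S
    Disconnects-lift (y , z , y∉SH , z∉SH , ¬yz) = rep y , rep z , rep-∉S y∉SH , rep-∉S z∉SH , ¬yz ∘ project-Conn

    HasEvenComponents-lift : HasEvenComponents H SH → HasEvenComponents G S
    HasEvenComponents-lift components-even L L-component with component-classification L-component
    ... | inj₁ (K , K-component , refl) = liftComponent-even K-component (components-even K K-component)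
    ... | inj₂ L-even = L-even

    IsTwoSep-lift : IsTwoSep H SH → IsTwoSep G S
    IsTwoSep-lift (p , q , SH≡ , p≢q , disconnects , components-even) =
      rep p , rep q , S≡ , (λ eq → p≢q (trans (sym (ι∘rep p)) (trans (cong ι eq) (ι∘rep q)))) ,
      subst (Disconnects G) S≡ (Disconnects-lift (subst (Disconnects H) (sym SH≡) disconnects)) ,
      subst (HasEvenComponents G) S≡ (HasEvenComponents-lift (subst (HasEvenComponents H) (sym SH≡) components-even))
      where
      S≡ = rep-pair SH≡

    pullback-isComponent : ∀ K → IsComponent H SH K → ι u1 ∉ K → xbar ∉ K → IsComponent G S (pullback G H ι K)
    pullback-isComponent K K-component ι-u1∉K xbar∉K =
      subst (IsComponent G S) (⊆-antisym from to) (liftComponent-isComponent K-component)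
      where
      to : ∀ {v} → v ∈ pullback G H ι K → v ∈ liftComponent K
      to {v} v∈ with v ∈? X | lookup⇒[]= (ι v) K (trans (sym (lookup∘tabulate _ v)) ([]=⇒lookup v∈))
      ... | yes v∈X | ιv∈K = subst (_∈ liftComponent K) (rep∘ι (inj₁ v∈X)) (rep∈liftComponent K-component ιv∈K)
      ... | no v∉X | ιv∈K = ⊥-elim (xbar∉K (subst (_∈ K) (outside v v∉X) ιv∈K))
      from : ∀ {v} → v ∈ liftComponent K → v ∈ pullback G H ι K
      from {v} v∈ with Rep? v
      ... | yes rep-v = lookup⇒[]= v (pullback G H ι K)
                          (trans (lookup∘tabulate _ v) ([]=⇒lookup (liftComponent-Rep K-component rep-v v∈)))
      ... | no ¬rep-v = ⊥-elim ([ xbar∉K , ι-u1∉K ]′ (liftComponent-¬Rep K-component ¬rep-v v∈))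

    ι-u1-adjacent-xbar : Adjacent H (ι u1) xbar
    ι-u1-adjacent-xbar with u1-outside-neighbour
    ... | w , w∉X , u1w = subst (Adjacent H (ι u1)) (outside w w∉X) (ι-adjacent u1w (inj₁ u1∈X))

    ι-u1∈K⇒xbar∈K : ∀ {K} → IsComponent H SH K → ι u1 ∈ K → xbar ∉ SH → xbar ∈ K
    ι-u1∈K⇒xbar∈K K-component u∈K xbar∉SH = IsComponent-closed H K-component u∈K
      (Step⇒Conn H (IsComponent-∉ H K-component u∈K , xbar∉SH , ι-u1-adjacent-xbar))

    outside-shadow∈ : ∀ {K} → IsComponent H SH K → ι u1 ∈ K ⊎ xbar ∈ K → outside-shadow ∈ K
    outside-shadow∈ K-component touches with xbar ∈? SH | touches
    ... | yes _ | inj₁ u∈K = u∈K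
    ... | yes xbar∈SH | inj₂ x∈K = ⊥-elim (IsComponent-∉ H K-component x∈K xbar∈SH)
    ... | no xbar∉SH | inj₁ u∈K = ι-u1∈K⇒xbar∈K K-component u∈K xbar∉SH
    ... | no _ | inj₂ x∈K = x∈K

    touching-component-unique : ∀ K K′ → IsComponent H SH K → IsComponent H SH K′ →
      ι u1 ∈ K ⊎ xbar ∈ K → ι u1 ∈ K′ ⊎ xbar ∈ K′ → K ≡ K′
    touching-component-unique _ _ K-component K′-component touches touches′ =
      IsComponent-unique H K-component K′-component (outside-shadow∈ K-component touches) (outside-shadow∈ K′-component touches′)

-- Parts (i) and (ii) hold for every vertex set SH of H.
lemma2p1 : (G : Graph) → IsMatchingCovered G →
  (X : VSet G) (u1 u2 : Vtx G) → IsTwoSepCut G X u1 u2 →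
  (H : Graph) (xbar : Vtx H) (ι : Vtx G → Vtx H) → IsContraction G X H xbar ι →
  (SH : VSet H) → (IsTwoSep H SH ⊎ IsBarrier H SH) →
  let S = liftSet G H X xbar ι u2 SH in
  (∀ K → IsComponent H SH K → ι u1 ∉ K → xbar ∉ K →
     IsComponent G S (pullback G H ι K)) ×
  (∀ K K' → IsComponent H SH K → IsComponent H SH K' →
     (ι u1 ∈ K ⊎ xbar ∈ K) → (ι u1 ∈ K' ⊎ xbar ∈ K') → K ≡ K') ×
  (IsBarrier H SH → IsBarrier G S) ×
  (IsTwoSep H SH → IsTwoSep G S)
lemma2p1 G G-matchingCovered X u1 u2 cut H xbar ι contraction SH _ =
  pullback-isComponent , touching-component-unique , IsBarrier-lift , IsTwoSep-lift
  where
  open Contraction G G-matchingCovered X u1 u2 cut H xbar ι contraction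
  open Lift SH
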